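{- Let $A=(a_{ij})$ be a real $m\times n$ matrix and suppose $(\mathcal P,\mathcal H,\mathcal F)$ is a rank $d$ representation of $A$, with $\mathcal P=\{p_1,\dots,p_m\}\subset\mathbb R^d$. Then $\Sigma_{\mathrm{thresh}}(A)\subseteq\mathcal T(\mathcal P)$.
   Context: A rank $d$ representation of $A$ consists of vectors $p_1,\dots,p_m\in\mathbb R^d$, vectors $h_1,\dots,h_n\in\mathbb R^d$ and monotone functions $f_1,\dots,f_n:\mathbb R\to\mathbb R$ with $a_{ij}=f_j(p_i\cdot h_j)$ for all $i,j$. For $j\in[n]$ and $\theta\in\mathbb R\setminus\{a_{1j},\dots,a_{mj}\}$ let $\sigma_j(\theta)=(\operatorname{sign}(a_{1j}-\theta),\dots,\operatorname{sign}(a_{mj}-\theta))\in\{+,-\}^m$, and $\Sigma_{\mathrm{thresh}}(A)=\{\pm\sigma_j(\theta)\}$ over all such $j,\theta$. The topes $\mathcal T(\mathcal P)$ are the sign vectors $\sigma_H\in\{+,-\}^m$ obtained from affine hyperplanes $H=\{v: v\cdot h=c\}$ ($h\neq 0$) containing no $p_i$, with $(\sigma_H)_i=+$ if $p_i\cdot h>c$ and $-$ if $p_i\cdot h<c$. -}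

module Defs where

open import Level using (0ℓ)
open import Data.Nat using (ℕ; zero; suc)
open import Data.Fin using (Fin; zero; suc)
open import Data.Product using (Σ; ∃; _×_; _,_)
open import Data.Sum using (_⊎_; inj₁; inj₂)
open import Relation.Nullary using (¬_)
open import Relation.Binary.PropositionalEquality using (_≡_)
open import Relation.Binary.Definitions using (Trichotomous)

-- The real numbers, axiomatised as a complete ordered field
-- (this determines ℝ up to isomorphism).
record RealField : Set₁ where
  infixl 6 _+_
  infixl 7 _*_
  infix 4 _<_ _≤_
  field
    Carrier : Set
    _+_ _*_ : Carrier → Carrier → Carrier
    -_ : Carrier → Carrier
    0# 1# : Carrier
    _<_ : Carrier → Carrier → Set
    +-assoc : ∀ x y z → (x + y) + z ≡ x + (y + z)
    +-comm : ∀ x y → x + y ≡ y + x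
    +-identityˡ : ∀ x → 0# + x ≡ x
    +-inverseʳ : ∀ x → x + (- x) ≡ 0#
    *-assoc : ∀ x y z → (x * y) * z ≡ x * (y * z)
    *-comm : ∀ x y → x * y ≡ y * x
    *-identityˡ : ∀ x → 1# * x ≡ x
    distribˡ : ∀ x y z → x * (y + z) ≡ (x * y) + (x * z)
    0≢1 : ¬ (0# ≡ 1#)
    *-inverse : ∀ x → ¬ (x ≡ 0#) → ∃ λ y → x * y ≡ 1#
    <-irrefl : ∀ x → ¬ (x < x)
    <-trans : ∀ {x y z} → x < y → y < z → x < z
    <-tri : Trichotomous _≡_ _<_
    +-mono-< : ∀ {x y} z → x < y → x + z < y + z
    *-pos : ∀ {x y} → 0# < x → 0# < y → 0# < x * y
  _≤_ : Carrier → Carrier → Set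
  x ≤ y = (x < y) ⊎ (x ≡ y)
  field
    complete : (S : Carrier → Set) → (∃ λ x → S x) →
               (∃ λ b → ∀ x → S x → x ≤ b) →
               ∃ λ s → (∀ x → S x → x ≤ s) × (∀ b → (∀ x → S x → x ≤ b) → s ≤ b)

data Sign : Set where
  plus minus : Sign

negSign : Sign → Sign
negSign plus = minus
negSign minus = plus

module _ (R : RealField) where
  open RealField R

  sumFin : ∀ {d} → (Fin d → Carrier) → Carrier
  sumFin {zero} f = 0#
  sumFin {suc d} f = f zero + sumFin (λ k → f (suc k))

  dot : ∀ {d} → (Fin d → Carrier) → (Fin d → Carrier) → Carrier
  dot u v = sumFin (λ k → u k * v k)

  Monotone : (Carrier → Carrier) → Set
  Monotone f = (∀ x y → x ≤ y → f x ≤ f y) ⊎ (∀ x y → x ≤ y → f y ≤ f x)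

  IsSignVec : ∀ {m} → (Fin m → Carrier) → Carrier → (Fin m → Sign) → Set
  IsSignVec a θ s = ∀ i → ((s i ≡ plus) × (θ < a i)) ⊎ ((s i ≡ minus) × (a i < θ))

  InThresh : ∀ {m n} → (Fin m → Fin n → Carrier) → (Fin m → Sign) → Set
  InThresh {m} {n} A s =
    Σ (Fin n) λ j → Σ Carrier λ θ →
      (∀ i → ¬ (A i j ≡ θ)) ×
      (IsSignVec (λ i → A i j) θ s ⊎ IsSignVec (λ i → A i j) θ (λ i → negSign (s i)))

  IsTope : ∀ {m d} → (Fin m → Fin d → Carrier) → (Fin m → Sign) → Set
  IsTope {m} {d} p s =
    Σ (Fin d → Carrier) λ h → Σ Carrier λ c →
      ¬ (∀ k → h k ≡ 0#) ×
      (∀ i → ¬ (dot (p i) h ≡ c)) ×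
      (∀ i → ((s i ≡ plus) × (c < dot (p i) h)) ⊎ ((s i ≡ minus) × (dot (p i) h < c)))

  IsRepresentation : ∀ {m n d} → (Fin m → Fin n → Carrier) →
    (Fin m → Fin d → Carrier) → (Fin n → Fin d → Carrier) → (Fin n → Carrier → Carrier) → Set
  IsRepresentation {m} {n} A p h f =
    (∀ j → Monotone (f j)) × (∀ i j → A i j ≡ f j (dot (p i) (h j)))

-- Along column j the entries are a_ij = f_j (p_i · h_j) with f_j monotone, so a threshold θ on
-- the column also splits the values y_i = p_i · h_j: every row of sign + has y strictly above
-- every row of sign − when f_j is non-decreasing, strictly below when it is non-increasing
-- (and then −h_j puts it above). Finitely many values so separated leave a gap L < U between
-- the two groups, and the hyperplane v · 2h = L + U realises the sign vector. If h_j = 0 all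
-- the y_i coincide, so the sign vector is constant and any nonzero normal works.
module Submission where

open import Level using (0ℓ)
open import Data.Nat using (zero; suc)
open import Data.Fin using (Fin; zero; suc)
open import Data.Fin.Properties using (all?)
open import Data.Product using (∃₂; _×_; _,_)
open import Data.Sum using (_⊎_; inj₁; inj₂; [_,_])
open import Function using (_∘_)
open import Relation.Nullary using (¬_; yes; no; contradiction)
open import Relation.Binary.PropositionalEquality
  using (_≡_; _≗_; refl; sym; trans; cong; cong₂; subst; subst₂; isEquivalence)
open import Relation.Binary.Bundles using (StrictPartialOrder; TotalOrder)
open import Relation.Binary.Structures using (IsStrictTotalOrder)
open import Relation.Binary.Definitions using (tri<; tri≈; tri>)
open import Algebra.Bundles using (CommutativeRing)
open import Algebra.Structures using (IsCommutativeRing)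
open import Algebra.Consequences.Propositional using (comm∧idˡ⇒id; comm∧invʳ⇒inv; comm∧distrˡ⇒distrʳ)
import Relation.Binary.Construct.StrictToNonStrict as NonStrict
import Relation.Binary.Reasoning.StrictPartialOrder as <-Reasoning
import Algebra.Construct.NaturalChoice.Min as Min
import Algebra.Construct.NaturalChoice.Max as Max
import Algebra.Properties.Ring as RingProperties
import Algebra.Properties.CommutativeSemigroup as CommutativeSemigroupProperties

open import Defs

module Hyperplanes (R : RealField) where
  open RealField R renaming (Carrier to ℝ; +-mono-< to +-monoˡ-<)

  +-*-isCommutativeRing : IsCommutativeRing _≡_ _+_ _*_ -_ 0# 1#
  +-*-isCommutativeRing = record
    { isRing = record
      { +-isAbelianGroup = record
        { isGroup = record
          { isMonoid = record
            { isSemigroup = record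
              { isMagma = record { isEquivalence = isEquivalence ; ∙-cong = cong₂ _+_ }
              ; assoc = +-assoc
              }
            ; identity = comm∧idˡ⇒id +-comm +-identityˡ
            }
          ; inverse = comm∧invʳ⇒inv +-comm +-inverseʳ
          ; ⁻¹-cong = cong -_
          }
        ; comm = +-comm
        }
      ; *-cong = cong₂ _*_
      ; *-assoc = *-assoc
      ; *-identity = comm∧idˡ⇒id *-comm *-identityˡ
      ; distrib = distribˡ , comm∧distrˡ⇒distrʳ *-comm distribˡ
      }
    ; *-comm = *-comm
    }

  +-*-commutativeRing : CommutativeRing 0ℓ 0ℓ
  +-*-commutativeRing = record { isCommutativeRing = +-*-isCommutativeRing }

  open CommutativeRing +-*-commutativeRing using (+-identityʳ; zeroʳ; ring; +-commutativeSemigroup)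
  open RingProperties ring using (-1*x≈-x; -‿involutive; -0#≈0#; xyx⁻¹≈y; +-inverseʳ-unique)
  open CommutativeSemigroupProperties +-commutativeSemigroup using (interchange)

  <-isStrictTotalOrder : IsStrictTotalOrder _≡_ _<_
  <-isStrictTotalOrder = record
    { isStrictPartialOrder = record
      { isEquivalence = isEquivalence
      ; irrefl = λ { refl → <-irrefl _ }
      ; trans = <-trans
      ; <-resp-≈ = (λ { refl x<y → x<y }) , (λ { refl x<y → x<y })
      }
    ; compare = <-tri
    }

  open IsStrictTotalOrder <-isStrictTotalOrder
    using (isStrictPartialOrder; irrefl; <-respˡ-≈; <-respʳ-≈; _≟_)

  <-strictPartialOrder : StrictPartialOrder 0ℓ 0ℓ 0ℓ
  <-strictPartialOrder = record { isStrictPartialOrder = isStrictPartialOrder }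

  open <-Reasoning <-strictPartialOrder

  ≤-totalOrder : TotalOrder 0ℓ 0ℓ 0ℓ
  ≤-totalOrder = record { isTotalOrder = NonStrict.isTotalOrder _≡_ _<_ <-isStrictTotalOrder }

  open TotalOrder ≤-totalOrder using () renaming (refl to ≤-refl; trans to ≤-trans)
  open Min ≤-totalOrder using (_⊓_; x⊓y≤x; x⊓y≤y; ⊓-sel)
  open Max ≤-totalOrder using (_⊔_; x≤x⊔y; x≤y⊔x; ⊔-sel)

  <-≤-trans : ∀ {x y z} → x < y → y ≤ z → x < z
  <-≤-trans = NonStrict.<-≤-trans _≡_ _<_ <-trans <-respʳ-≈

  ≤-<-trans : ∀ {x y z} → x ≤ y → y < z → x < z
  ≤-<-trans = NonStrict.≤-<-trans _≡_ _<_ sym <-trans <-respˡ-≈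

  <⇒≱ : ∀ {x y} → x < y → ¬ (y ≤ x)
  <⇒≱ {x} x<y y≤x = <-irrefl x (<-≤-trans x<y y≤x)

  ≰⇒> : ∀ {x y} → ¬ (x ≤ y) → y < x
  ≰⇒> {x} {y} x≰y with <-tri x y
  ... | tri< x<y _ _ = contradiction (inj₁ x<y) x≰y
  ... | tri≈ _ x≡y _ = contradiction (inj₂ x≡y) x≰y
  ... | tri> _ _ y<x = y<x

  ⊓-glb-< : ∀ {z x y} → z < x → z < y → z < x ⊓ y
  ⊓-glb-< {z} {x} {y} z<x z<y with ⊓-sel x y
  ... | inj₁ x⊓y≡x = subst (z <_) (sym x⊓y≡x) z<x
  ... | inj₂ x⊓y≡y = subst (z <_) (sym x⊓y≡y) z<y

  ⊔-lub-< : ∀ {z x y} → x < z → y < z → x ⊔ y < z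
  ⊔-lub-< {z} {x} {y} x<z y<z with ⊔-sel x y
  ... | inj₁ x⊔y≡x = subst (_< z) (sym x⊔y≡x) x<z
  ... | inj₂ x⊔y≡y = subst (_< z) (sym x⊔y≡y) y<z

  nondecreasing-reflects-< : ∀ {f : ℝ → ℝ} → (∀ x y → x ≤ y → f x ≤ f y) →
                             ∀ {x y} → f x < f y → x < y
  nondecreasing-reflects-< f↑ fx<fy = ≰⇒> (λ y≤x → <⇒≱ fx<fy (f↑ _ _ y≤x))

  nonincreasing-reflects-< : ∀ {f : ℝ → ℝ} → (∀ x y → x ≤ y → f y ≤ f x) →
                             ∀ {x y} → f x < f y → y < x
  nonincreasing-reflects-< f↓ fx<fy = ≰⇒> (λ x≤y → <⇒≱ fx<fy (f↓ _ _ x≤y))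

  +-monoʳ-< : ∀ z {x y} → x < y → z + x < z + y
  +-monoʳ-< z {x} {y} x<y = subst₂ _<_ (+-comm x z) (+-comm y z) (+-monoˡ-< z x<y)

  +-mono-< : ∀ {a b c e} → a < b → c < e → a + c < b + e
  +-mono-< {b = b} {c = c} a<b c<e = <-trans (+-monoˡ-< c a<b) (+-monoʳ-< b c<e)

  +-mono-≤-< : ∀ {a b c e} → a ≤ b → c < e → a + c < b + e
  +-mono-≤-< (inj₁ a<b) c<e = +-mono-< a<b c<e
  +-mono-≤-< (inj₂ refl) c<e = +-monoʳ-< _ c<e

  +-mono-<-≤ : ∀ {a b c e} → a < b → c ≤ e → a + c < b + e
  +-mono-<-≤ a<b (inj₁ c<e) = +-mono-< a<b c<e
  +-mono-<-≤ a<b (inj₂ refl) = +-monoˡ-< _ a<b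

  -‿anti-< : ∀ {x y} → x < y → - y < - x
  -‿anti-< {x} {y} x<y = begin-strict
    - y              ≡⟨ +-identityˡ (- y) ⟨
    0# + - y         ≡⟨ cong (_+ - y) (+-inverseʳ x) ⟨
    (x + - x) + - y  <⟨ +-monoˡ-< (- y) (+-monoˡ-< (- x) x<y) ⟩
    (y + - x) + - y  ≡⟨ xyx⁻¹≈y y (- x) ⟩
    - x              ∎

  0<1 : 0# < 1#
  0<1 with <-tri 0# 1#
  ... | tri< 0<1 _ _ = 0<1
  ... | tri≈ _ 0≡1 _ = contradiction 0≡1 0≢1
  ... | tri> _ _ 1<0 = contradiction (<-trans 1<0 0<[-1]*[-1]) (<-irrefl 1#)
    where
    0<-1 : 0# < - 1#
    0<-1 = subst (_< - 1#) -0#≈0# (-‿anti-< 1<0)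

    0<[-1]*[-1] : 0# < 1#
    0<[-1]*[-1] = subst (0# <_) (trans (-1*x≈-x (- 1#)) (-‿involutive 1#)) (*-pos 0<-1 0<-1)

  x-1<x : ∀ x → x + - 1# < x
  x-1<x x = subst (x + - 1# <_) (+-identityʳ x) (+-monoʳ-< x (subst (- 1# <_) -0#≈0# (-‿anti-< 0<1)))

  x<x+1 : ∀ x → x < x + 1#
  x<x+1 x = subst (_< x + 1#) (+-identityʳ x) (+-monoʳ-< x 0<1)

  x+x≡0⇒x≡0 : ∀ {x} → x + x ≡ 0# → x ≡ 0#
  x+x≡0⇒x≡0 {x} x+x≡0 with <-tri x 0#
  ... | tri< x<0 _ _ = contradiction (subst₂ _<_ x+x≡0 (+-identityˡ 0#) (+-mono-< x<0 x<0)) (<-irrefl 0#)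
  ... | tri≈ _ x≡0 _ = x≡0
  ... | tri> _ _ 0<x = contradiction (subst₂ _<_ (+-identityˡ 0#) x+x≡0 (+-mono-< 0<x 0<x)) (<-irrefl 0#)

  dot-distribʳ-+ : ∀ {d} (u v w : Fin d → ℝ) → dot R u (λ k → v k + w k) ≡ dot R u v + dot R u w
  dot-distribʳ-+ {zero} _ _ _ = sym (+-identityˡ 0#)
  dot-distribʳ-+ {suc d} u v w =
    trans (cong₂ _+_ (distribˡ (u zero) (v zero) (w zero)) (dot-distribʳ-+ (u ∘ suc) (v ∘ suc) (w ∘ suc)))
          (interchange _ _ _ _)

  dot-zeroʳ : ∀ {d} (u v : Fin d → ℝ) → (∀ k → v k ≡ 0#) → dot R u v ≡ 0#
  dot-zeroʳ {zero} _ _ _ = refl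
  dot-zeroʳ {suc d} u v v≡0 =
    trans (cong₂ _+_ (trans (cong (u zero *_) (v≡0 zero)) (zeroʳ (u zero)))
                     (dot-zeroʳ (u ∘ suc) (v ∘ suc) (v≡0 ∘ suc)))
          (+-identityˡ 0#)

  dot-negʳ : ∀ {d} (u v : Fin d → ℝ) → dot R u (λ k → - v k) ≡ - dot R u v
  dot-negʳ u v = +-inverseʳ-unique (dot R u v) _
    (trans (sym (dot-distribʳ-+ u v (λ k → - v k))) (dot-zeroʳ u _ (λ k → +-inverseʳ (v k))))

  AllSigned : ∀ {m} → Sign → (Fin m → Sign) → (Fin m → ℝ) → (ℝ → Set) → Set
  AllSigned σ s y P = ∀ {i} → s i ≡ σ → P (y i)

  Separates : ∀ {m} → (Fin m → ℝ) → (Fin m → Sign) → Set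
  Separates y s = ∀ {i k} → s i ≡ plus → s k ≡ minus → y k < y i

  Separable : ∀ {m} → (Fin m → ℝ) → (Fin m → Sign) → Set
  Separable y s = Separates y s ⊎ Separates y (negSign ∘ s)

  separates-resp-≗ : ∀ {m} {y z : Fin m → ℝ} {s} → y ≗ z → Separates y s → Separates z s
  separates-resp-≗ y≗z sep sᵢ sₖ = subst₂ _<_ (y≗z _) (y≗z _) (sep sᵢ sₖ)

  signVec⇒separates : ∀ {m} {a : Fin m → ℝ} {θ s} → IsSignVec R a θ s → Separates a s
  signVec⇒separates sv {i} {k} sᵢ sₖ with sv i | sv k
  ... | inj₁ (_ , θ<aᵢ) | inj₂ (_ , aₖ<θ) = <-trans aₖ<θ θ<aᵢ
  ... | inj₂ (sᵢ≡minus , _) | _ = contradiction (trans (sym sᵢ) sᵢ≡minus) λ ()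
  ... | inj₁ _ | inj₁ (sₖ≡plus , _) = contradiction (trans (sym sₖ≡plus) sₖ) λ ()

  negSign≡⇒≡negSign : ∀ {σ τ} → negSign σ ≡ τ → σ ≡ negSign τ
  negSign≡⇒≡negSign {plus} refl = refl
  negSign≡⇒≡negSign {minus} refl = refl

  separates-∘-monotone⇒separable : ∀ {m} {f : ℝ → ℝ} {y : Fin m → ℝ} {s} →
    Monotone R f → Separates (f ∘ y) s → Separable y s
  separates-∘-monotone⇒separable (inj₁ f↑) sep =
    inj₁ (λ sᵢ sₖ → nondecreasing-reflects-< f↑ (sep sᵢ sₖ))
  separates-∘-monotone⇒separable (inj₂ f↓) sep =
    inj₂ (λ sᵢ sₖ → nonincreasing-reflects-< f↓
                      (sep (negSign≡⇒≡negSign sₖ) (negSign≡⇒≡negSign sᵢ)))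

  separable-negSign⇒separable : ∀ {m} {y : Fin m → ℝ} {s} → Separable y (negSign ∘ s) → Separable y s
  separable-negSign⇒separable (inj₁ sep) = inj₂ sep
  separable-negSign⇒separable (inj₂ sep) =
    inj₁ (λ sᵢ sₖ → sep (cong (negSign ∘ negSign) sᵢ) (cong (negSign ∘ negSign) sₖ))

  separates-negSign⇒separates-neg : ∀ {m} {y : Fin m → ℝ} {s} →
    Separates y (negSign ∘ s) → Separates (λ i → - y i) s
  separates-negSign⇒separates-neg sep sᵢ sₖ = -‿anti-< (sep (cong negSign sₖ) (cong negSign sᵢ))

  strict-bounds : ∀ {m} (y : Fin m → ℝ) → ∃₂ λ lo hi → lo < hi × (∀ i → lo < y i) × (∀ i → y i < hi)
  strict-bounds {zero} y = 0# , 1# , 0<1 , (λ ()) , (λ ())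
  strict-bounds {suc m} y =
    let lo , hi , lo<hi , lo<y , y<hi = strict-bounds (y ∘ suc)
    in lo ⊓ (y zero + - 1#) , hi ⊔ (y zero + 1#) ,
       ≤-<-trans (x⊓y≤x lo _) (<-≤-trans lo<hi (x≤x⊔y hi _)) ,
       (λ { zero    → ≤-<-trans (x⊓y≤y lo _) (x-1<x (y zero))
          ; (suc i) → ≤-<-trans (x⊓y≤x lo _) (lo<y i) }) ,
       (λ { zero    → <-≤-trans (x<x+1 (y zero)) (x≤y⊔x hi _)
          ; (suc i) → <-≤-trans (y<hi i) (x≤x⊔y hi _) })

  -- Adding a point of sign + lowers hi to hi ⊓ y₀, one of sign − raises lo to lo ⊔ y₀.
  separates⇒gap-within : ∀ {m} (y : Fin m → ℝ) (s : Fin m → Sign) → Separates y s →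
    ∀ {lo hi} → lo < hi → AllSigned plus s y (lo <_) → AllSigned minus s y (_< hi) →
    ∃₂ λ L U → L < U × lo ≤ L × U ≤ hi × AllSigned minus s y (_≤ L) × AllSigned plus s y (U ≤_)
  separates⇒gap-within {zero} _ _ _ {lo} {hi} lo<hi _ _ =
    lo , hi , lo<hi , ≤-refl , ≤-refl , (λ { {()} }) , (λ { {()} })
  separates⇒gap-within {suc m} y s sep {lo} {hi} lo<hi lo<plus minus<hi with s zero in s₀
  ... | plus =
    let L , U , L<U , lo≤L , U≤hi⊓y₀ , minus≤L , U≤plus =
          separates⇒gap-within (y ∘ suc) (s ∘ suc) sep (⊓-glb-< lo<hi (lo<plus s₀)) lo<plus
            (λ sₖ → ⊓-glb-< (minus<hi sₖ) (sep s₀ sₖ))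
    in L , U , L<U , lo≤L , ≤-trans U≤hi⊓y₀ (x⊓y≤x hi _) ,
       (λ { {zero}  s₀≡minus → contradiction (trans (sym s₀) s₀≡minus) λ ()
          ; {suc k} sₖ       → minus≤L sₖ }) ,
       (λ { {zero}  _  → ≤-trans U≤hi⊓y₀ (x⊓y≤y hi _)
          ; {suc i} sᵢ → U≤plus sᵢ })
  ... | minus =
    let L , U , L<U , lo⊔y₀≤L , U≤hi , minus≤L , U≤plus =
          separates⇒gap-within (y ∘ suc) (s ∘ suc) sep (⊔-lub-< lo<hi (minus<hi s₀))
            (λ sᵢ → ⊔-lub-< (lo<plus sᵢ) (sep sᵢ s₀)) minus<hi
    in L , U , L<U , ≤-trans (x≤x⊔y lo _) lo⊔y₀≤L , U≤hi ,
       (λ { {zero}  _  → ≤-trans (x≤y⊔x lo _) lo⊔y₀≤L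
          ; {suc k} sₖ → minus≤L sₖ }) ,
       (λ { {zero}  s₀≡plus → contradiction (trans (sym s₀) s₀≡plus) λ ()
          ; {suc i} sᵢ      → U≤plus sᵢ })

  HasGap : ∀ {m} → (Fin m → ℝ) → (Fin m → Sign) → Set
  HasGap y s = ∃₂ λ L U → L < U × AllSigned minus s y (_≤ L) × AllSigned plus s y (U ≤_)

  separates⇒gap : ∀ {m} (y : Fin m → ℝ) (s : Fin m → Sign) → Separates y s → HasGap y s
  separates⇒gap y s sep =
    let lo , hi , lo<hi , lo<y , y<hi = strict-bounds y
        L , U , L<U , _ , _ , minus≤L , U≤plus =
          separates⇒gap-within y s sep lo<hi (λ {i} _ → lo<y i) (λ {k} _ → y<hi k)
    in L , U , L<U , minus≤L , U≤plus

  -- Doubling the normal puts the hyperplane at the midpoint (L + U)/2 without dividing by 2.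
  gap⇒tope : ∀ {m d} (p : Fin m → Fin d → ℝ) (s : Fin m → Sign) (g : Fin d → ℝ) →
    ¬ (∀ k → g k ≡ 0#) → HasGap (λ i → dot R (p i) g) s → IsTope R p s
  gap⇒tope p s g g≢0 (L , U , L<U , minus≤L , U≤plus) = 2g , L + U , 2g≢0 , off-hyperplane , side
    where
    2g : _ → ℝ
    2g k = g k + g k

    2g≢0 : ¬ (∀ k → 2g k ≡ 0#)
    2g≢0 2g≡0 = g≢0 (λ k → x+x≡0⇒x≡0 (2g≡0 k))

    dot-2g : ∀ i → dot R (p i) 2g ≡ dot R (p i) g + dot R (p i) g
    dot-2g i = dot-distribʳ-+ (p i) g g

    side : ∀ i → ((s i ≡ plus) × (L + U < dot R (p i) 2g)) ⊎ ((s i ≡ minus) × (dot R (p i) 2g < L + U))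
    side i with s i in sᵢ
    ... | plus  = inj₁ (refl , subst (L + U <_) (sym (dot-2g i))
                                 (+-mono-<-≤ (<-≤-trans L<U (U≤plus sᵢ)) (U≤plus sᵢ)))
    ... | minus = inj₂ (refl , subst (_< L + U) (sym (dot-2g i))
                                 (+-mono-≤-< (minus≤L sᵢ) (≤-<-trans (minus≤L sᵢ) L<U)))

    off-hyperplane : ∀ i → ¬ (dot R (p i) 2g ≡ L + U)
    off-hyperplane i on with side i
    ... | inj₁ (_ , c<x) = irrefl (sym on) c<x
    ... | inj₂ (_ , x<c) = irrefl on x<c

  separates⇒tope : ∀ {m d} (p : Fin m → Fin (suc d) → ℝ) (s : Fin m → Sign) (g : Fin (suc d) → ℝ) →
    Separates (λ i → dot R (p i) g) s → IsTope R p s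
  separates⇒tope p s g sep with all? (λ k → g k ≟ 0#)
  ... | no g≢0 = gap⇒tope p s g g≢0 (separates⇒gap _ s sep)
  ... | yes g≡0 = gap⇒tope p s e₀ (λ e₀≡0 → 0≢1 (sym (e₀≡0 zero))) (separates⇒gap _ s vacuous)
    where
    e₀ : Fin (suc _) → ℝ
    e₀ zero = 1#
    e₀ (suc _) = 0#

    -- with g = 0 every point has value 0, so sep is never applicable: s is constant
    vacuous : Separates (λ i → dot R (p i) e₀) s
    vacuous {i} {k} sᵢ sₖ =
      contradiction (sep sᵢ sₖ) (irrefl (trans (dot-zeroʳ (p k) g g≡0) (sym (dot-zeroʳ (p i) g g≡0))))

  separable⇒tope : ∀ {m d} (p : Fin m → Fin (suc d) → ℝ) (s : Fin m → Sign) (g : Fin (suc d) → ℝ) →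
    Separable (λ i → dot R (p i) g) s → IsTope R p s
  separable⇒tope p s g (inj₁ sep) = separates⇒tope p s g sep
  separable⇒tope p s g (inj₂ sep) =
    separates⇒tope p s (λ k → - g k)
      (separates-resp-≗ {y = λ i → - dot R (p i) g} (λ i → sym (dot-negʳ (p i) g))
        (separates-negSign⇒separates-neg {s = s} sep))

-- Data.Nat's _≤_ would clash with the order on ℝ inside Hyperplanes.
open import Data.Nat using (ℕ; _≤_)

lemma3p6 : (R : RealField) → (m n d : ℕ) → 1 ≤ d →
    (A : Fin m → Fin n → RealField.Carrier R) →
    (p : Fin m → Fin d → RealField.Carrier R) →
    (h : Fin n → Fin d → RealField.Carrier R) →
    (f : Fin n → RealField.Carrier R → RealField.Carrier R) →
    IsRepresentation R A p h f →
    (s : Fin m → Sign) → InThresh R A s → IsTope R p s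
lemma3p6 R m n (suc d) _ A p h f (f-monotone , A≡f[p·h]) s (j , θ , _ , thresholded) =
  separable⇒tope p s (h j) ([ column-separable , separable-negSign⇒separable ∘ column-separable ] thresholded)
  where
  open Hyperplanes R

  column-separable : ∀ {t} → IsSignVec R (λ i → A i j) θ t → Separable (λ i → dot R (p i) (h j)) t
  column-separable sv =
    separates-∘-monotone⇒separable (f-monotone j)
      (separates-resp-≗ (λ i → A≡f[p·h] i j) (signVec⇒separates sv))
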